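{- The generic order expansion of the semigeneric $\omega$-partite tournament has no local SWIR.
   Context: For an oriented graph $A$ and distinct $x,y$ write $x\perp y$ if there is no directed edge between them. $A$ is an $\omega$-partite tournament if $\perp$ (with equality) is an equivalence relation (classes are parts). The semigeneric class $\mathcal{C}$ consists of finite $\omega$-partite tournaments $A$ such that for all $U_0,U_1\subseteq A$ with $|U_0|=|U_1|=2$ and $U_0,U_1$ contained in two different parts, the number of directed edges from $U_0$ to $U_1$ is even. The generic order expansion of the semigeneric $\omega$-partite tournament is the Fraïssé limit of the class of finite structures in the language $\{\to,<\}$ whose $\to$-reduct lies in $\mathcal{C}$ and in which $<$ is a linear order. A local SWIR on a Fraïssé (countable ultrahomogeneous) structure $M$ is a ternary relation $B\mathop{\smile\!\!\!\!\!\!|}_A C$ on finite substructures with $A$ non-empty satisfying, with $AB$ the substructure on $A\cup B$: Invariance under $\mathrm{Aut}(M)$; Existence (for all $A,B,C$ there is $g\in\mathrm{Aut}(M)$ fixing $A$ pointwise with $gB\mathop{\smile\!\!\!\!\!\!|}_A C$, and $h$ fixing $A$ pointwise with $B\mathop{\smile\!\!\!\!\!\!|}_A hC$); Stationarity (if $B\mathop{\smile\!\!\!\!\!\!|}_A C$, $B'\mathop{\smile\!\!\!\!\!\!|}_A C$ and an automorphism fixing $A$ pointwise restricts to $\sigma:B\to B'$, then an automorphism fixing $AC$ pointwise restricts to $\sigma$; and the symmetric right version); Monotonicity ($BD\mathop{\smile\!\!\!\!\!\!|}_A C\Rightarrow B\mathop{\smile\!\!\!\!\!\!|}_A C\wedge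 D\mathop{\smile\!\!\!\!\!\!|}_{AB}C$; $B\mathop{\smile\!\!\!\!\!\!|}_A CD\Rightarrow B\mathop{\smile\!\!\!\!\!\!|}_A C\wedge B\mathop{\smile\!\!\!\!\!\!|}_{AC}D$). -}

module Defs where

open import Data.Bool using (Bool; true; false)
open import Data.Nat using (ℕ; _+_)
open import Data.Nat.Divisibility using (_∣_)
open import Data.Fin using (Fin)
open import Data.List using (List; []; map; _++_)
open import Data.List.Membership.Propositional using (_∈_)
open import Data.List.Relation.Binary.Subset.Propositional using (_⊆_)
open import Data.Product using (Σ; _×_; _,_)
open import Data.Sum using (_⊎_)
open import Data.Empty using (⊥)
open import Relation.Nullary using (¬_)
open import Relation.Binary.PropositionalEquality using (_≡_; _≢_)
open import Function.Definitions using (Injective)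

record Str (X : Set) : Set where
  field
    E : X → X → Bool   -- directed edge x → y
    L : X → X → Bool   -- x < y
open Str public

module _ {X : Set} (S : Str X) where

  Perp : X → X → Set
  Perp x y = (x ≢ y) × (E S x y ≡ false) × (E S y x ≡ false)

  PerpEq : X → X → Set
  PerpEq x y = (x ≡ y) ⊎ Perp x y

  IsOriented : Set
  IsOriented = (∀ x → E S x x ≡ false) × (∀ x y → E S x y ≡ true → E S y x ≡ false)

  -- ⊥ ∪ = is an equivalence relation (reflexivity and symmetry are automatic)
  IsOmegaPartite : Set
  IsOmegaPartite = IsOriented × (∀ x y z → PerpEq x y → PerpEq y z → PerpEq x z)

  b2n : Bool → ℕ
  b2n true  = 1
  b2n false = 0

  IsSemigeneric : Set
  IsSemigeneric = ∀ a b c d → Perp a b → Perp c d → ¬ PerpEq a c →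
    2 ∣ (b2n (E S a c) + b2n (E S a d) + b2n (E S b c) + b2n (E S b d))

  IsLinearOrder : Set
  IsLinearOrder = (∀ x → L S x x ≡ false)
                × (∀ x y z → L S x y ≡ true → L S y z ≡ true → L S x z ≡ true)
                × (∀ x y → x ≢ y → (L S x y ≡ true) ⊎ (L S y x ≡ true))

  InK : Set
  InK = IsOmegaPartite × IsSemigeneric × IsLinearOrder

induced : ∀ {n} → Str ℕ → (Fin n → ℕ) → Str (Fin n)
induced M ι = record { E = λ i j → E M (ι i) (ι j) ; L = λ i j → L M (ι i) (ι j) }

record Aut (M : Str ℕ) : Set where
  field
    fun  : ℕ → ℕ
    inv  : ℕ → ℕ
    invˡ : ∀ x → inv (fun x) ≡ x
    invʳ : ∀ x → fun (inv x) ≡ x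
    presE : ∀ x y → E M (fun x) (fun y) ≡ E M x y
    presL : ∀ x y → L M (fun x) (fun y) ≡ L M x y
open Aut public

-- M is (a copy of) the Fraïssé limit of K, the generic order expansion
-- of the semigeneric ω-partite tournament:
--   age(M) ⊆ K, K ⊆ age(M) (up to isomorphism), and M ultrahomogeneous.
IsGenericOrderExpansion : Str ℕ → Set
IsGenericOrderExpansion M =
    (∀ n (ι : Fin n → ℕ) → Injective _≡_ _≡_ ι → InK (induced M ι))
  × (∀ n (S : Str (Fin n)) → InK S →
       Σ (Fin n → ℕ) λ ι → Injective _≡_ _≡_ ι
         × (∀ i j → E M (ι i) (ι j) ≡ E S i j)
         × (∀ i j → L M (ι i) (ι j) ≡ L S i j))
  × (∀ n (ι₁ ι₂ : Fin n → ℕ) → Injective _≡_ _≡_ ι₁ → Injective _≡_ _≡_ ι₂ →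
       (∀ i j → E M (ι₁ i) (ι₁ j) ≡ E M (ι₂ i) (ι₂ j)) →
       (∀ i j → L M (ι₁ i) (ι₁ j) ≡ L M (ι₂ i) (ι₂ j)) →
       Σ (Aut M) λ g → ∀ i → fun g (ι₁ i) ≡ ι₂ i)

-- Local SWIR. Finite substructures are represented by lists of their
-- elements; the relation is required to depend only on the underlying sets.

_≈ˢ_ : List ℕ → List ℕ → Set
A ≈ˢ A' = (A ⊆ A') × (A' ⊆ A)

Fixes : {M : Str ℕ} → Aut M → List ℕ → Set
Fixes g A = ∀ {a} → a ∈ A → fun g a ≡ a

record IsLocalSWIR (M : Str ℕ) (Ind : List ℕ → List ℕ → List ℕ → Set) : Set where
  -- Ind A B C  stands for  B ⫫_A C
  field
    extensional : ∀ A A' B B' C C' → A ≈ˢ A' → B ≈ˢ B' → C ≈ˢ C' →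
                  Ind A B C → Ind A' B' C'
    invariance  : ∀ A B C (g : Aut M) → A ≢ [] → Ind A B C →
                  Ind (map (fun g) A) (map (fun g) B) (map (fun g) C)
    existenceˡ  : ∀ A B C → A ≢ [] →
                  Σ (Aut M) λ g → Fixes g A × Ind A (map (fun g) B) C
    existenceʳ  : ∀ A B C → A ≢ [] →
                  Σ (Aut M) λ h → Fixes h A × Ind A B (map (fun h) C)
    -- g fixing A restricts to σ : B → B' = g[B]
    stationarityˡ : ∀ A B C (g : Aut M) → A ≢ [] → Fixes g A →
                  Ind A B C → Ind A (map (fun g) B) C →
                  Σ (Aut M) λ h → Fixes h (A ++ C) × (∀ {b} → b ∈ B → fun h b ≡ fun g b)
    stationarityʳ : ∀ A B C (g : Aut M) → A ≢ [] → Fixes g A →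
                  Ind A B C → Ind A B (map (fun g) C) →
                  Σ (Aut M) λ h → Fixes h (A ++ B) × (∀ {c} → c ∈ C → fun h c ≡ fun g c)
    monotonicityˡ : ∀ A B C D → A ≢ [] → Ind A (B ++ D) C →
                  Ind A B C × Ind (A ++ B) D C
    monotonicityʳ : ∀ A B C D → A ≢ [] → Ind A B (C ++ D) →
                  Ind A B C × Ind (A ++ C) B D

HasLocalSWIR : Str ℕ → Set₁
HasLocalSWIR M = Σ (List ℕ → List ℕ → List ℕ → Set) λ Ind → IsLocalSWIR M Ind

-- Suppose ⫫ is a local SWIR on M, and embed in M a structure S ∈ K with a < a′ in one part,
-- a → c → a′ and a, a′ → c′. Over a, c and c′ are conjugate, so stationarity gives
-- (b → c) = (b → c′) for every b ⫫_a a′cc′. Over a′, c is conjugate to a vertex d and c′ to a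
-- vertex d′ with d → a′ → d′ and d ⊥ d′, so for b′ ⫫_a′ a c c′ d′ d with b′ ⊥ a′ the parity
-- condition on {a′, b′} and {d′, d} gives (b′ → c) ≠ (b′ → c′). By monotonicity both kinds of
-- points are independent from c and c′ over {a, a′}, so by stationarity no b of the first kind
-- has the same type over {a, a′} as a b′ of the second kind. But existence yields points of the
-- first kind in the part of a both below a and not below a (not a′ itself, as a′ separates c
-- from c′), and points of the second kind both above a′ and below a′ (not a itself): two of them
-- share a position.

module Submission where

open import Defs
open import Data.Bool using (Bool; true; false; not)
open import Data.Bool.Properties using () renaming (_≟_ to _≟ᴮ_)
open import Data.Nat using (ℕ; _+_; _<ᵇ_; _≟_)
open import Data.Nat.Divisibility using (_∣_; _∣?_)
open import Data.Fin using (Fin; zero; suc; toℕ; #_)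
open import Data.Fin.Properties using (all?) renaming (_≟_ to _≟ᶠ_)
open import Data.Vec.Functional using (toList) renaming ([] to []ᵛ; _∷_ to _∷ᵛ_)
open import Data.List using (List; []; _∷_; [_]; _++_; map)
open import Data.List.Membership.Propositional using (_∈_)
open import Data.List.Membership.Propositional.Properties using (∈-++⁺ʳ; ∈-++⁻; ∈-tabulate⁻)
open import Data.List.Relation.Unary.Any using (here; there)
open import Data.List.Relation.Binary.Subset.Propositional using (_⊆_)
open import Data.List.Relation.Binary.Subset.Propositional.Properties using (⊆-refl; ⊆-reflexive-↭; xs⊆ys++xs; ∈-∷⁺ʳ)
open import Data.List.Relation.Binary.Permutation.Propositional using (_↭_; ↭-refl; ↭-sym; ↭-swap)
open import Data.Product using (Σ; _×_; _,_; proj₁; proj₂)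
open import Data.Sum using (inj₁; inj₂; [_,_]′)
open import Data.Empty using (⊥; ⊥-elim)
open import Function using (id)
open import Function.Definitions using (Injective)
open import Relation.Nullary using (¬_; Dec; yes; no)
open import Relation.Nullary.Decidable using (_×-dec_; _⊎-dec_; _→-dec_; ¬?; from-yes; from-no)
open import Relation.Binary.PropositionalEquality hiding ([_])

private variable
  X : Set
  n : ℕ
  x y z w : X
  A B C C′ : List ℕ

≡true⇒≢false : ∀ {b} → b ≡ true → b ≢ false
≡true⇒≢false refl ()

module _ (S : Str (Fin n)) where

  Perp? : ∀ i j → Dec (Perp S i j)
  Perp? i j = ¬? (i ≟ᶠ j) ×-dec (E S i j ≟ᴮ false) ×-dec (E S j i ≟ᴮ false)

  PerpEq? : ∀ i j → Dec (PerpEq S i j)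
  PerpEq? i j = (i ≟ᶠ j) ⊎-dec Perp? i j

  IsOmegaPartite? : Dec (IsOmegaPartite S)
  IsOmegaPartite? =
    (all? (λ i → E S i i ≟ᴮ false)
      ×-dec all? λ i → all? λ j → (E S i j ≟ᴮ true) →-dec (E S j i ≟ᴮ false))
    ×-dec all? λ i → all? λ j → all? λ k → PerpEq? i j →-dec (PerpEq? j k →-dec PerpEq? i k)

  IsSemigeneric? : Dec (IsSemigeneric S)
  IsSemigeneric? = all? λ i → all? λ j → all? λ k → all? λ l →
    Perp? i j →-dec (Perp? k l →-dec (¬? (PerpEq? i k) →-dec
      (2 ∣? (b2n S (E S i k) + b2n S (E S i l) + b2n S (E S j k) + b2n S (E S j l)))))

  IsLinearOrder? : Dec (IsLinearOrder S)
  IsLinearOrder? = all? (λ i → L S i i ≟ᴮ false)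
    ×-dec (all? λ i → all? λ j → all? λ k →
             (L S i j ≟ᴮ true) →-dec ((L S j k ≟ᴮ true) →-dec (L S i k ≟ᴮ true)))
    ×-dec (all? λ i → all? λ j → ¬? (i ≟ᶠ j) →-dec ((L S i j ≟ᴮ true) ⊎-dec (L S j i ≟ᴮ true)))

  InK? : Dec (InK S)
  InK? = IsOmegaPartite? ×-dec IsSemigeneric? ×-dec IsLinearOrder?

[]ᵛ-injective : Injective _≡_ _≡_ ([]ᵛ {A = X})
[]ᵛ-injective {x = ()}

∷ᵛ-injective : {v : Fin n → X} → (∀ i → v i ≢ x) → Injective _≡_ _≡_ v → Injective _≡_ _≡_ (x ∷ᵛ v)
∷ᵛ-injective x∉v v-inj {zero}  {zero}  _       = refl
∷ᵛ-injective x∉v v-inj {zero}  {suc j} x≡vj    = ⊥-elim (x∉v j (sym x≡vj))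
∷ᵛ-injective x∉v v-inj {suc i} {zero}  vi≡x    = ⊥-elim (x∉v i vi≡x)
∷ᵛ-injective x∉v v-inj {suc i} {suc j} vi≡vj   = cong suc (v-inj vi≡vj)

injective₁ : (x : X) → Injective _≡_ _≡_ (x ∷ᵛ []ᵛ)
injective₁ x = ∷ᵛ-injective (λ ()) []ᵛ-injective

injective₂ : x ≢ y → Injective _≡_ _≡_ (x ∷ᵛ y ∷ᵛ []ᵛ)
injective₂ x≢y = ∷ᵛ-injective (λ { zero → ≢-sym x≢y }) (injective₁ _)

injective₃ : x ≢ y → x ≢ z → y ≢ z → Injective _≡_ _≡_ (x ∷ᵛ y ∷ᵛ z ∷ᵛ []ᵛ)
injective₃ x≢y x≢z y≢z =
  ∷ᵛ-injective (λ { zero → ≢-sym x≢y ; (suc zero) → ≢-sym x≢z }) (injective₂ y≢z)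

injective₄ : x ≢ y → x ≢ z → x ≢ w → y ≢ z → y ≢ w → z ≢ w →
             Injective _≡_ _≡_ (x ∷ᵛ y ∷ᵛ z ∷ᵛ w ∷ᵛ []ᵛ)
injective₄ x≢y x≢z x≢w y≢z y≢w z≢w =
  ∷ᵛ-injective (λ { zero → ≢-sym x≢y ; (suc zero) → ≢-sym x≢z ; (suc (suc zero)) → ≢-sym x≢w })
               (injective₃ y≢z y≢w z≢w)

Perp-sym : {S : Str X} → Perp S x y → Perp S y x
Perp-sym (x≢y , xy , yx) = ≢-sym x≢y , yx , xy

record SameRelationsTo (S : Str X) (u x y : X) : Set where
  constructor same-relations
  field
    E-from : E S x u ≡ E S y u
    E-to   : E S u x ≡ E S u y
    L-from : L S x u ≡ L S y u
    L-to   : L S u x ≡ L S u y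
open SameRelationsTo

SameTypeOver : Str X → (Fin n → X) → X → X → Set
SameTypeOver S v x y = ∀ i → SameRelationsTo S (v i) x y

ConjugateOver : (M : Str ℕ) → List ℕ → ℕ → ℕ → Set
ConjugateOver M A x y = Σ (Aut M) λ g → Fixes g A × fun g x ≡ y

odd-edge-count : {S : Str X} {p q r s : Bool} → p ≡ true → q ≡ false → r ≡ s →
                 ¬ 2 ∣ b2n S p + b2n S q + b2n S r + b2n S s
odd-edge-count {r = true}  refl refl refl = from-no (2 ∣? 3)
odd-edge-count {r = false} refl refl refl = from-no (2 ∣? 1)

module _ {M : Str ℕ} where

  inverse : Aut M → Aut M
  inverse g = record
    { fun = inv g ; inv = fun g ; invˡ = invʳ g ; invʳ = invˡ g
    ; presE = λ x y → trans (sym (presE g (inv g x) (inv g y))) (cong₂ (E M) (invʳ g x) (invʳ g y))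
    ; presL = λ x y → trans (sym (presL g (inv g x) (inv g y))) (cong₂ (L M) (invʳ g x) (invʳ g y))
    }

  Fixes-inverse : (g : Aut M) → Fixes g A → Fixes (inverse g) A
  Fixes-inverse g g-fixes {a} a∈A = trans (cong (inv g) (sym (g-fixes a∈A))) (invˡ g a)

  map-fixed : (g : Aut M) (A : List ℕ) → Fixes g A → map (fun g) A ≡ A
  map-fixed g []      _       = refl
  map-fixed g (a ∷ A) g-fixes =
    cong₂ _∷_ (g-fixes (here refl)) (map-fixed g A (λ a∈A → g-fixes (there a∈A)))

  Perp-image : (g : Aut M) → Perp M x y → Perp M (fun g x) (fun g y)
  Perp-image {x} {y} g (x≢y , xy , yx) =
    (λ gx≡gy → x≢y (trans (sym (invˡ g x)) (trans (cong (inv g) gx≡gy) (invˡ g y))))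
    , trans (presE g x y) xy , trans (presE g y x) yx

  Perp-fixed : (g : Aut M) → fun g y ≡ y → Perp M x y → Perp M (fun g x) y
  Perp-fixed g gy≡y x⊥y = subst (Perp M _) gy≡y (Perp-image g x⊥y)

  L-to-fixed : (g : Aut M) → fun g y ≡ y → L M (fun g x) y ≡ L M x y
  L-to-fixed {y} {x} g gy≡y = trans (cong (L M (fun g x)) (sym gy≡y)) (presL g x y)

  L-from-fixed : (g : Aut M) → fun g y ≡ y → L M y (fun g x) ≡ L M y x
  L-from-fixed {y} {x} g gy≡y = trans (cong (λ u → L M u (fun g x)) (sym gy≡y)) (presL g y x)

≈ˢ-refl : A ≈ˢ A
≈ˢ-refl = ⊆-refl , ⊆-refl

↭⇒≈ˢ : A ↭ B → A ≈ˢ B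
↭⇒≈ˢ A↭B = ⊆-reflexive-↭ A↭B , ⊆-reflexive-↭ (↭-sym A↭B)

module LocalSWIR {M : Str ℕ} {Ind : List ℕ → List ℕ → List ℕ → Set} (swir : IsLocalSWIR M Ind) where
  open IsLocalSWIR swir

  private
    monotone-in-prefix : A ≢ [] → C′ ⊆ C → Ind A B C → Ind A B C′ × Ind (A ++ C′) B C
    monotone-in-prefix {A} {C′} {C} {B} A≢[] C′⊆C ind =
      monotonicityʳ A B C′ C A≢[] (extensional A A B B C (C′ ++ C) ≈ˢ-refl ≈ˢ-refl C≈C′++C ind)
      where
      C≈C′++C : C ≈ˢ (C′ ++ C)
      C≈C′++C = xs⊆ys++xs C C′ , λ x∈C′++C → [ C′⊆C , id ]′ (∈-++⁻ C′ x∈C′++C)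

  Ind-restrict : A ≢ [] → C′ ⊆ C → Ind A B C → Ind A B C′
  Ind-restrict A≢[] C′⊆C ind = proj₁ (monotone-in-prefix A≢[] C′⊆C ind)

  Ind-restrict-∈ : A ≢ [] → z ∈ C → Ind A B C → Ind A B [ z ]
  Ind-restrict-∈ A≢[] z∈C = Ind-restrict A≢[] (∈-∷⁺ʳ z∈C (λ ()))

  Ind-extend-base : A ≢ [] → C′ ⊆ C → Ind A B C → Ind (A ++ C′) B C
  Ind-extend-base A≢[] C′⊆C ind = proj₂ (monotone-in-prefix A≢[] C′⊆C ind)

  stationary-agree : A ≢ [] → ConjugateOver M A x y → Ind A [ x ] [ z ] → Ind A [ y ] [ z ] →
                     E M x z ≡ E M y z
  stationary-agree {A} {x} {y} {z} A≢[] (g , g-fixes , gx≡y) ind ind′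
    with stationarityˡ A [ x ] [ z ] g A≢[] g-fixes ind (subst (λ u → Ind A [ u ] [ z ]) (sym gx≡y) ind′)
  ... | h , h-fixes , h≗g = begin
    E M x z                 ≡⟨ sym (presE h x z) ⟩
    E M (fun h x) (fun h z) ≡⟨ cong₂ (E M) hx≡y (h-fixes (∈-++⁺ʳ A (here refl))) ⟩
    E M y z                 ∎
    where
    open ≡-Reasoning
    hx≡y : fun h x ≡ y
    hx≡y = trans (h≗g (here refl)) gx≡y

  independent-agree : A ≢ [] → ConjugateOver M A y z → Ind A [ x ] [ y ] → Ind A [ x ] [ z ] →
                      E M x y ≡ E M x z
  independent-agree {A} {y} {z} {x} A≢[] (g , g-fixes , gy≡z) ind ind′ = begin
    E M x y                 ≡⟨ sym (presE g x y) ⟩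
    E M (fun g x) (fun g y) ≡⟨ cong (E M (fun g x)) gy≡z ⟩
    E M (fun g x) z         ≡⟨ stationary-agree A≢[] g⁻¹ moved ind′ ⟩
    E M x z                 ∎
    where
    open ≡-Reasoning
    g⁻¹ : ConjugateOver M A (fun g x) x
    g⁻¹ = inverse g , Fixes-inverse g g-fixes , invˡ g x
    moved : Ind A [ fun g x ] [ z ]
    moved = subst₂ (λ A′ u → Ind A′ [ fun g x ] [ u ]) (map-fixed g A g-fixes) gy≡z
                   (invariance A [ x ] [ y ] g A≢[] ind)

module GenericOrderExpansion {M : Str ℕ} (gen : IsGenericOrderExpansion M) where

  private
    axioms : (ι : Fin n → ℕ) → Injective _≡_ _≡_ ι → InK (induced M ι)
    axioms = proj₁ gen _

  E-irrefl : ∀ x → E M x x ≡ false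
  E-irrefl x with axioms (x ∷ᵛ []ᵛ) (injective₁ x)
  ... | ((irreflexive , _) , _) , _ = irreflexive zero

  L-irrefl : ∀ x → L M x x ≡ false
  L-irrefl x with axioms (x ∷ᵛ []ᵛ) (injective₁ x)
  ... | _ , _ , irreflexive , _ = irreflexive zero

  L⇒≢ : L M x y ≡ true → x ≢ y
  L⇒≢ {x} x<y refl = ≡true⇒≢false x<y (L-irrefl x)

  L-asym : L M x y ≡ true → L M y x ≡ false
  L-asym {x} {y} x<y with L M y x in y<x
  ... | false = refl
  ... | true with axioms (x ∷ᵛ y ∷ᵛ []ᵛ) (injective₂ (L⇒≢ x<y))
  ...   | _ , _ , _ , transitive , _ =
    ⊥-elim (≡true⇒≢false (transitive zero (suc zero) zero x<y y<x) (L-irrefl x))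

  L-trans : L M x y ≡ true → L M y z ≡ true → L M x z ≡ true
  L-trans {x} {y} {z} x<y y<z with axioms (x ∷ᵛ y ∷ᵛ z ∷ᵛ []ᵛ) (injective₃ (L⇒≢ x<y) x≢z (L⇒≢ y<z))
    where
    x≢z : x ≢ z
    x≢z refl = ≡true⇒≢false y<z (L-asym x<y)
  ... | _ , _ , _ , transitive , _ = transitive zero (suc zero) (suc (suc zero)) x<y y<z

  L-flip : x ≢ y → L M y x ≡ not (L M x y)
  L-flip {x} {y} x≢y with L M x y in Lxy
  ... | true = L-asym Lxy
  ... | false with axioms (x ∷ᵛ y ∷ᵛ []ᵛ) (injective₂ x≢y)
  ...   | _ , _ , _ , _ , total with total zero (suc zero) (λ ())
  ...     | inj₁ x<y = ⊥-elim (≡true⇒≢false x<y Lxy)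
  ...     | inj₂ y<x = y<x

  Perp-trans : Perp M x y → Perp M y z → x ≢ z → Perp M x z
  Perp-trans {x} {y} {z} (x≢y , xy , yx) (y≢z , yz , zy) x≢z
    with axioms (x ∷ᵛ y ∷ᵛ z ∷ᵛ []ᵛ) (injective₃ x≢y x≢z y≢z)
  ... | (_ , PerpEq-trans) , _
    with PerpEq-trans zero (suc zero) (suc (suc zero)) (inj₂ ((λ ()) , xy , yx)) (inj₂ ((λ ()) , yz , zy))
  ...   | inj₂ (_ , xz , zx) = x≢z , xz , zx

  semigeneric-parity : {a b c d : ℕ} → Perp M a b → Perp M c d → E M a c ≡ true → E M a d ≡ false →
                       E M b c ≢ E M b d
  semigeneric-parity {a} {b} {c} {d} a⊥b@(a≢b , ab , _) c⊥d@(c≢d , _ , dc) a→c a↛d bc≡bd =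
    odd-edge-count {S = induced M abcd} a→c a↛d bc≡bd
      (even zero (suc zero) (suc (suc zero)) (suc (suc (suc zero)))
            ((λ ()) , proj₂ a⊥b) ((λ ()) , proj₂ c⊥d) a≁c)
    where
    a≢c : a ≢ c
    a≢c refl = ≡true⇒≢false a→c (E-irrefl a)
    a≢d : a ≢ d
    a≢d refl = ≡true⇒≢false a→c dc
    b≢c : b ≢ c
    b≢c refl = ≡true⇒≢false a→c ab
    b≢d : b ≢ d
    b≢d refl = ≡true⇒≢false a→c (proj₁ (proj₂ (Perp-trans a⊥b (Perp-sym {S = M} c⊥d) a≢c)))
    abcd : Fin 4 → ℕ
    abcd = a ∷ᵛ b ∷ᵛ c ∷ᵛ d ∷ᵛ []ᵛ
    even : IsSemigeneric (induced M abcd)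
    even = proj₁ (proj₂ (axioms abcd (injective₄ a≢b a≢c a≢d b≢c b≢d c≢d)))
    a≁c : ¬ PerpEq (induced M abcd) zero (suc (suc zero))
    a≁c (inj₂ (_ , a↛c , _)) = ≡true⇒≢false a→c a↛c

  conjugate-over : (v : Fin n → ℕ) → Injective _≡_ _≡_ v → (∀ i → v i ≢ x) → (∀ i → v i ≢ y) →
                   SameTypeOver M v x y → ConjugateOver M (toList v) x y
  conjugate-over {x = x} {y = y} v v-inj x∉v y∉v same = g , Fixes-v , g-maps zero
    where
    E-agree : ∀ i j → E M ((x ∷ᵛ v) i) ((x ∷ᵛ v) j) ≡ E M ((y ∷ᵛ v) i) ((y ∷ᵛ v) j)
    E-agree zero    zero    = trans (E-irrefl x) (sym (E-irrefl y))
    E-agree zero    (suc j) = E-from (same j)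
    E-agree (suc i) zero    = E-to (same i)
    E-agree (suc i) (suc j) = refl
    L-agree : ∀ i j → L M ((x ∷ᵛ v) i) ((x ∷ᵛ v) j) ≡ L M ((y ∷ᵛ v) i) ((y ∷ᵛ v) j)
    L-agree zero    zero    = trans (L-irrefl x) (sym (L-irrefl y))
    L-agree zero    (suc j) = L-from (same j)
    L-agree (suc i) zero    = L-to (same i)
    L-agree (suc i) (suc j) = refl
    conjugation : Σ (Aut M) λ g → ∀ i → fun g ((x ∷ᵛ v) i) ≡ (y ∷ᵛ v) i
    conjugation = proj₂ (proj₂ gen) _ (x ∷ᵛ v) (y ∷ᵛ v)
                    (∷ᵛ-injective x∉v v-inj) (∷ᵛ-injective y∉v v-inj) E-agree L-agree
    g : Aut M
    g = proj₁ conjugation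
    g-maps : ∀ i → fun g ((x ∷ᵛ v) i) ≡ (y ∷ᵛ v) i
    g-maps = proj₂ conjugation
    Fixes-v : Fixes g (toList v)
    Fixes-v u∈v with ∈-tabulate⁻ u∈v
    ... | i , refl = g-maps (suc i)

  same-position-SameTypeOver : (v : Fin n → ℕ) → (∀ i → Perp M x (v i)) → (∀ i → Perp M y (v i)) →
                               (∀ i → L M x (v i) ≡ L M y (v i)) → SameTypeOver M v x y
  same-position-SameTypeOver {x = x} {y = y} v x⊥v y⊥v same-L i = same-relations
    (trans (proj₁ (proj₂ (x⊥v i))) (sym (proj₁ (proj₂ (y⊥v i)))))
    (trans (proj₂ (proj₂ (x⊥v i))) (sym (proj₂ (proj₂ (y⊥v i)))))
    (same-L i)
    (begin
      L M (v i) x        ≡⟨ L-flip (proj₁ (x⊥v i)) ⟩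
      not (L M x (v i))  ≡⟨ cong not (same-L i) ⟩
      not (L M y (v i))  ≡⟨ L-flip (proj₁ (y⊥v i)) ⟨
      L M (v i) y        ∎)
    where open ≡-Reasoning

-- Vertices 0 < 1 < ⋯ < 7, called lo, a, a′, hi, c, c′, d′, d below;
-- the parts are {0,1,2,3}, {4}, {5}, {6,7}.
S-edge : ℕ → ℕ → Bool
S-edge 0 4 = true
S-edge 1 4 = true
S-edge 3 4 = true
S-edge 4 2 = true
S-edge 0 5 = true
S-edge 1 5 = true
S-edge 2 5 = true
S-edge 3 5 = true
S-edge 0 6 = true
S-edge 1 6 = true
S-edge 2 6 = true
S-edge 3 6 = true
S-edge 7 0 = true
S-edge 7 1 = true
S-edge 7 2 = true
S-edge 7 3 = true
S-edge 4 5 = true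
S-edge 4 6 = true
S-edge 4 7 = true
S-edge 5 6 = true
S-edge 5 7 = true
S-edge _ _ = false

S : Str (Fin 8)
S = record { E = λ i j → S-edge (toℕ i) (toℕ j) ; L = λ i j → toℕ i <ᵇ toℕ j }

-- Opaque so that unification never unfolds the decision procedure.
opaque
  S∈K : InK S
  S∈K = from-yes (InK? S)

module NoLocalSWIR {M : Str ℕ} (gen : IsGenericOrderExpansion M)
                      {Ind : List ℕ → List ℕ → List ℕ → Set} (swir : IsLocalSWIR M Ind) where
  open GenericOrderExpansion gen
  open LocalSWIR swir
  open IsLocalSWIR swir using (existenceˡ; extensional)

  private
    S↪M : Σ (Fin 8 → ℕ) λ ι → Injective _≡_ _≡_ ι
            × (∀ i j → E M (ι i) (ι j) ≡ E S i j) × (∀ i j → L M (ι i) (ι j) ≡ L S i j)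
    S↪M = proj₁ (proj₂ gen) 8 S S∈K

  ι : Fin 8 → ℕ
  ι = proj₁ S↪M

  ι-injective : Injective _≡_ _≡_ ι
  ι-injective = proj₁ (proj₂ S↪M)

  ι-E : ∀ i j → E M (ι i) (ι j) ≡ E S i j
  ι-E = proj₁ (proj₂ (proj₂ S↪M))

  ι-L : ∀ i j → L M (ι i) (ι j) ≡ L S i j
  ι-L = proj₂ (proj₂ (proj₂ S↪M))

  ι-Perp : {i j : Fin 8} → Perp S i j → Perp M (ι i) (ι j)
  ι-Perp {i} {j} (i≢j , ij , ji) =
    (λ ιi≡ιj → i≢j (ι-injective ιi≡ιj)) , trans (ι-E i j) ij , trans (ι-E j i) ji

  ι-SameRelationsTo : {u i j : Fin 8} → SameRelationsTo S u i j → SameRelationsTo M (ι u) (ι i) (ι j)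
  ι-SameRelationsTo {u} {i} {j} (same-relations e₁ e₂ l₁ l₂) = same-relations
    (trans (ι-E i u) (trans e₁ (sym (ι-E j u))))
    (trans (ι-E u i) (trans e₂ (sym (ι-E u j))))
    (trans (ι-L i u) (trans l₁ (sym (ι-L j u))))
    (trans (ι-L u i) (trans l₂ (sym (ι-L u j))))

  ι-conjugate : (σ : Fin n → Fin 8) {i j : Fin 8} → Injective _≡_ _≡_ σ →
                (∀ k → σ k ≢ i) → (∀ k → σ k ≢ j) → SameTypeOver S σ i j →
                ConjugateOver M (toList (λ k → ι (σ k))) (ι i) (ι j)
  ι-conjugate σ σ-inj i∉σ j∉σ same =
    conjugate-over (λ k → ι (σ k)) (λ e → σ-inj (ι-injective e))
      (λ k e → i∉σ k (ι-injective e)) (λ k e → j∉σ k (ι-injective e))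
      (λ k → ι-SameRelationsTo (same k))

  lo a a′ hi c c′ d′ d : ℕ
  lo = ι (# 0)
  a  = ι (# 1)
  a′ = ι (# 2)
  hi = ι (# 3)
  c  = ι (# 4)
  c′ = ι (# 5)
  d′ = ι (# 6)
  d  = ι (# 7)

  Cᵃ Cᵃ′ : List ℕ
  Cᵃ  = a′ ∷ c ∷ c′ ∷ []
  Cᵃ′ = a ∷ c ∷ c′ ∷ d′ ∷ d ∷ []

  a⊥a′ : Perp M a a′
  a⊥a′ = ι-Perp ((λ ()) , refl , refl)

  a′⊥a : Perp M a′ a
  a′⊥a = Perp-sym {S = M} a⊥a′

  c≈c′-over-a : ConjugateOver M [ a ] c c′
  c≈c′-over-a = ι-conjugate (# 1 ∷ᵛ []ᵛ) (injective₁ _) (λ { zero () }) (λ { zero () })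
                  (λ { zero → same-relations refl refl refl refl })

  c≈d-over-a′ : ConjugateOver M [ a′ ] c d
  c≈d-over-a′ = ι-conjugate (# 2 ∷ᵛ []ᵛ) (injective₁ _) (λ { zero () }) (λ { zero () })
                  (λ { zero → same-relations refl refl refl refl })

  c′≈d′-over-a′ : ConjugateOver M [ a′ ] c′ d′
  c′≈d′-over-a′ = ι-conjugate (# 2 ∷ᵛ []ᵛ) (injective₁ _) (λ { zero () }) (λ { zero () })
                    (λ { zero → same-relations refl refl refl refl })

  c-c′-agree-over-a : Ind [ a ] [ x ] Cᵃ → E M x c ≡ E M x c′
  c-c′-agree-over-a ind = independent-agree (λ ()) c≈c′-over-a
    (Ind-restrict-∈ (λ ()) (there (here refl)) ind) (Ind-restrict-∈ (λ ()) (there (there (here refl))) ind)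

  c-c′-disagree-over-a′ : Ind [ a′ ] [ y ] Cᵃ′ → Perp M y a′ → E M y c ≢ E M y c′
  c-c′-disagree-over-a′ {y} ind y⊥a′ yc≡yc′ =
    semigeneric-parity (Perp-sym {S = M} y⊥a′) (ι-Perp ((λ ()) , refl , refl)) (ι-E (# 2) (# 6)) (ι-E (# 2) (# 7))
      (begin
        E M y d′  ≡⟨ c′-as-d′ ⟨
        E M y c′  ≡⟨ yc≡yc′ ⟨
        E M y c   ≡⟨ c-as-d ⟩
        E M y d   ∎)
    where
    open ≡-Reasoning
    restrict : ∀ {u} → u ∈ Cᵃ′ → Ind [ a′ ] [ y ] [ u ]
    restrict u∈Cᵃ′ = Ind-restrict-∈ (λ ()) u∈Cᵃ′ ind
    c-as-d : E M y c ≡ E M y d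
    c-as-d = independent-agree (λ ()) c≈d-over-a′
               (restrict (there (here refl))) (restrict (there (there (there (there (here refl))))))
    c′-as-d′ : E M y c′ ≡ E M y d′
    c′-as-d′ = independent-agree (λ ()) c′≈d′-over-a′
                 (restrict (there (there (here refl)))) (restrict (there (there (there (here refl)))))

  a′-dependent-over-a : ¬ Ind [ a ] [ a′ ] Cᵃ
  a′-dependent-over-a ind =
    ≡true⇒≢false (trans (c-c′-agree-over-a ind) (ι-E (# 2) (# 5))) (ι-E (# 2) (# 4))

  a-dependent-over-a′ : ¬ Ind [ a′ ] [ a ] Cᵃ′
  a-dependent-over-a′ ind =
    c-c′-disagree-over-a′ ind a⊥a′ (trans (ι-E (# 1) (# 4)) (sym (ι-E (# 1) (# 5))))

  Ind-over-aa′-from-a : Ind [ a ] [ x ] Cᵃ → Ind (a ∷ a′ ∷ []) [ x ] Cᵃ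
  Ind-over-aa′-from-a = Ind-extend-base (λ ()) (∈-∷⁺ʳ (here refl) (λ ()))

  Ind-over-aa′-from-a′ : Ind [ a′ ] [ y ] Cᵃ′ → Ind (a ∷ a′ ∷ []) [ y ] Cᵃ′
  Ind-over-aa′-from-a′ ind = extensional _ _ _ _ _ _ (↭⇒≈ˢ (↭-swap a′ a ↭-refl)) ≈ˢ-refl ≈ˢ-refl
                               (Ind-extend-base (λ ()) (∈-∷⁺ʳ (here refl) (λ ())) ind)

  record Witness (o : ℕ) (C : List ℕ) (below-a below-a′ : Bool) : Set where
    field
      point       : ℕ
      independent : Ind [ o ] [ point ] C
      perp-a      : Perp M point a
      perp-a′     : Perp M point a′
      position-a  : L M point a ≡ below-a
      position-a′ : L M point a′ ≡ below-a′
  open Witness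

  no-common-position : ∀ {p q} → Witness a Cᵃ p q → Witness a′ Cᵃ′ p q → ⊥
  no-common-position w w′ = c-c′-disagree-over-a′ (independent w′) (perp-a′ w′)
    (begin
      E M b′ c   ≡⟨ agree (there (here refl)) (there (here refl)) ⟨
      E M b c    ≡⟨ c-c′-agree-over-a (independent w) ⟩
      E M b c′   ≡⟨ agree (there (there (here refl))) (there (there (here refl))) ⟩
      E M b′ c′  ∎)
    where
    open ≡-Reasoning
    b b′ : ℕ
    b = point w
    b′ = point w′
    base : Fin 2 → ℕ
    base = a ∷ᵛ a′ ∷ᵛ []ᵛ
    b⊥base : ∀ i → Perp M b (base i)
    b⊥base zero       = perp-a w
    b⊥base (suc zero) = perp-a′ w
    b′⊥base : ∀ i → Perp M b′ (base i)
    b′⊥base zero       = perp-a w′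
    b′⊥base (suc zero) = perp-a′ w′
    same-position : ∀ i → L M b (base i) ≡ L M b′ (base i)
    same-position zero       = trans (position-a w) (sym (position-a w′))
    same-position (suc zero) = trans (position-a′ w) (sym (position-a′ w′))
    b≈b′ : ConjugateOver M (a ∷ a′ ∷ []) b b′
    b≈b′ = conjugate-over base (injective₂ (proj₁ a⊥a′))
            (λ i → ≢-sym (proj₁ (b⊥base i))) (λ i → ≢-sym (proj₁ (b′⊥base i)))
            (same-position-SameTypeOver base b⊥base b′⊥base same-position)
    agree : ∀ {u} → u ∈ Cᵃ → u ∈ Cᵃ′ → E M b u ≡ E M b′ u
    agree u∈Cᵃ u∈Cᵃ′ = stationary-agree (λ ()) b≈b′
      (Ind-restrict-∈ (λ ()) u∈Cᵃ (Ind-over-aa′-from-a (independent w)))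
      (Ind-restrict-∈ (λ ()) u∈Cᵃ′ (Ind-over-aa′-from-a′ (independent w′)))

  witness-below-a : Witness a Cᵃ true true
  witness-below-a with existenceˡ [ a ] [ lo ] Cᵃ (λ ())
  ... | g , g-fixes , ind = record
    { point = b ; independent = ind ; perp-a = b⊥a ; perp-a′ = Perp-trans b⊥a a⊥a′ (L⇒≢ b<a′)
    ; position-a = b<a ; position-a′ = b<a′ }
    where
    b : ℕ
    b = fun g lo
    b⊥a : Perp M b a
    b⊥a = Perp-fixed g (g-fixes (here refl)) (ι-Perp ((λ ()) , refl , refl))
    b<a : L M b a ≡ true
    b<a = trans (L-to-fixed g (g-fixes (here refl))) (ι-L (# 0) (# 1))
    b<a′ : L M b a′ ≡ true
    b<a′ = L-trans b<a (ι-L (# 1) (# 2))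

  witness-not-below-a : Σ Bool (Witness a Cᵃ false)
  witness-not-below-a with existenceˡ [ a ] [ a′ ] Cᵃ (λ ())
  ... | g , g-fixes , ind with fun g a′ ≟ a′
  ...   | yes b≡a′ = ⊥-elim (a′-dependent-over-a (subst (λ u → Ind [ a ] [ u ] Cᵃ) b≡a′ ind))
  ...   | no b≢a′ = L M b a′ , record
    { point = b ; independent = ind ; perp-a = b⊥a ; perp-a′ = Perp-trans b⊥a a⊥a′ b≢a′
    ; position-a = L-asym a<b ; position-a′ = refl }
    where
    b : ℕ
    b = fun g a′
    b⊥a : Perp M b a
    b⊥a = Perp-fixed g (g-fixes (here refl)) a′⊥a
    a<b : L M a b ≡ true
    a<b = trans (L-from-fixed g (g-fixes (here refl))) (ι-L (# 1) (# 2))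

  witness-above-a′ : Witness a′ Cᵃ′ false false
  witness-above-a′ with existenceˡ [ a′ ] [ hi ] Cᵃ′ (λ ())
  ... | g , g-fixes , ind = record
    { point = b′ ; independent = ind ; perp-a = Perp-trans b′⊥a′ a′⊥a (≢-sym (L⇒≢ a<b′))
    ; perp-a′ = b′⊥a′ ; position-a = L-asym a<b′ ; position-a′ = L-asym a′<b′ }
    where
    b′ : ℕ
    b′ = fun g hi
    b′⊥a′ : Perp M b′ a′
    b′⊥a′ = Perp-fixed g (g-fixes (here refl)) (ι-Perp ((λ ()) , refl , refl))
    a′<b′ : L M a′ b′ ≡ true
    a′<b′ = trans (L-from-fixed g (g-fixes (here refl))) (ι-L (# 2) (# 3))
    a<b′ : L M a b′ ≡ true
    a<b′ = L-trans (ι-L (# 1) (# 2)) a′<b′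

  witness-below-a′ : Σ Bool λ p → Witness a′ Cᵃ′ p true
  witness-below-a′ with existenceˡ [ a′ ] [ a ] Cᵃ′ (λ ())
  ... | g , g-fixes , ind with fun g a ≟ a
  ...   | yes b′≡a = ⊥-elim (a-dependent-over-a′ (subst (λ u → Ind [ a′ ] [ u ] Cᵃ′) b′≡a ind))
  ...   | no b′≢a = L M b′ a , record
    { point = b′ ; independent = ind ; perp-a = Perp-trans b′⊥a′ a′⊥a b′≢a
    ; perp-a′ = b′⊥a′ ; position-a = refl
    ; position-a′ = trans (L-to-fixed g (g-fixes (here refl))) (ι-L (# 1) (# 2)) }
    where
    b′ : ℕ
    b′ = fun g a
    b′⊥a′ : Perp M b′ a′
    b′⊥a′ = Perp-fixed g (g-fixes (here refl)) a⊥a′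

proposition5p22 : (M : Str ℕ) → IsGenericOrderExpansion M → ¬ HasLocalSWIR M
proposition5p22 M gen (Ind , swir) = pigeonhole witness-not-below-a witness-below-a′
  where
  open NoLocalSWIR gen swir
  pigeonhole : Σ Bool (Witness a Cᵃ false) → Σ Bool (λ p → Witness a′ Cᵃ′ p true) → ⊥
  pigeonhole (false , w) _            = no-common-position w witness-above-a′
  pigeonhole (true  , w) (false , w′) = no-common-position w w′
  pigeonhole (true  , _) (true  , w′) = no-common-position witness-below-a w′
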